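{- Suppose the jobs are indexed so that $w_1/p_1\ge w_2/p_2\ge\dots\ge w_n/p_n$. Let $\sigma$ be a proper schedule of $J$ and let $\sigma'$ be the intermediate schedule obtained from $\sigma$ by an admissible swap (at some step $j^*$ between machines $M_h$ and $M_i$). Writing $C_j$ and $C'_j$ for the completion time of job $j$ in $\sigma$ and $\sigma'$ respectively, we have $\sum_{j\in J}w_jC'_j\le\sum_{j\in J}w_jC_j$.
   Context: Setting: $m$ identical parallel machines $M_1,\dots,M_m$ and jobs $J=\{1,\dots,n\}$; job $j$ has positive integer processing time $p_j$ and nonnegative integer weight $w_j$. Let $p_{\max}=\max_j p_j$; for $J'\subseteq J$ let $P(J')=\sum_{j\in J'}p_j$; let $J_j=\{1,\dots,j\}$. A proper schedule $\sigma$ is a partition $J=J_1(\sigma)\cup\dots\cup J_m(\sigma)$ ($J_i(\sigma)$ = jobs on $M_i$), where each machine processes its jobs from time $0$ without idle time in increasing order of index. Let $J_{i,j}(\sigma)=J_i(\sigma)\cap J_j$. In any schedule, each machine processes its jobs in a given sequence without idle time from time $0$, and $C_j$ is the time job $j$ finishes. The swap: let $\sigma$ be a proper schedule, $j^*\in J$, and $h,i\in\{1,\dots,m\}$. The swap is admissible for $\sigma$ at step $j^*$ (with machines $M_h,M_i$) if (i) $j^*\in J_{h}(\sigma)$; (ii) $|J_i(\sigma)\setminus J_{i,j^*}(\sigma)|\ge 2p_{\max}$; (iii) $P(J_{h,j^*}(\sigma))-P(J_{i,j^*}(\sigma))\ge 4p_{\max}^2$. In that case let $J_I$ be the first $2p_{\max}$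 jobs (in processing order on $M_i$) of $J_i(\sigma)\setminus J_{i,j^*}(\sigma)$ and $J_H$ the last $2p_{\max}$ jobs (in processing order on $M_h$) of $J_{h,j^*}(\sigma)$. Choose nonempty $J_{H'}\subseteq J_H$ and $J_{I'}\subseteq J_I$ with $P(J_{H'})=P(J_{I'})$, and let $J_{H''}=J_H\setminus J_{H'}$, $J_{I''}=J_I\setminus J_{I'}$. The intermediate schedule $\sigma'$ changes only $M_h$ and $M_i$: on $M_h$ the consecutive block $J_H$ is replaced by the jobs of $J_{H''}$ (in their order in $\sigma$) followed by the jobs of $J_{I'}$ (in their order in $\sigma$); on $M_i$ the consecutive block $J_I$ is replaced by the jobs of $J_{H'}$ (in their order in $\sigma$) followed by the jobs of $J_{I''}$ (in their order in $\sigma$); all other jobs keep their machine and relative order, and machines process jobs without idle time. -}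

module Defs where

open import Data.Nat using (ℕ; zero; suc; _+_; _*_; _∸_; _≤_; _<_; _⊔_)
open import Data.Bool using (Bool; true; false; not)
open import Data.Fin as F using (Fin; toℕ)
open import Data.Fin.Properties using () renaming (_≟_ to _≟ᶠ_)
open import Data.List using (List; []; _∷_; _++_; map; filter; filterᵇ; length; take; drop; foldr; allFin)
open import Data.List.Membership.Propositional using (_∈_)
open import Data.Product using (_×_; _,_)
open import Data.Nat.ListAction using (sum)
open import Relation.Nullary using (¬_; does)
open import Relation.Binary.PropositionalEquality using (_≡_)

-- Jobs are Fin n (job with index j is the (toℕ j + 1)-th job), machines are Fin m.

pmax : ∀ {n} → (Fin n → ℕ) → ℕ
pmax {n} p = foldr _⊔_ 0 (map p (allFin n))

P : ∀ {n} → (Fin n → ℕ) → List (Fin n) → ℕ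
P p js = sum (map p js)

-- A general schedule: for each machine, the sequence of jobs it processes
-- (from time 0, without idle time, in list order).
Schedule : ℕ → ℕ → Set
Schedule n m = Fin m → List (Fin n)

-- A proper schedule is given by the partition J = J_1(σ) ∪ … ∪ J_m(σ),
-- encoded as the assignment  a : Fin n → Fin m  (job j is on machine a j);
-- each machine processes its jobs in increasing order of index.
properSchedule : ∀ {n m} → (Fin n → Fin m) → Schedule n m
properSchedule {n} a k = filter (λ j → a j ≟ᶠ k) (allFin n)

upTo : ∀ {n} → Fin n → List (Fin n) → List (Fin n)
upTo j* = filter (λ j → j F.≤? j*)

after : ∀ {n} → Fin n → List (Fin n) → List (Fin n)
after j* = filter (λ j → j* F.<? j)

completions : ∀ {n} → (Fin n → ℕ) → ℕ → List (Fin n) → List (Fin n × ℕ)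
completions p t [] = []
completions p t (j ∷ js) = (j , t + p j) ∷ completions p (t + p j) js

weightedCompletion : ∀ {n m} → (p w : Fin n → ℕ) → Schedule n m → ℕ
weightedCompletion {n} {m} p w S =
  sum (map (λ k → sum (map (λ { (j , c) → w j * c }) (completions p 0 (S k)))) (allFin m))

record Admissible {n m} (p : Fin n → ℕ) (a : Fin n → Fin m)
                  (j* : Fin n) (h i : Fin m) : Set where
  field
    cond-i   : j* ∈ properSchedule a h
    cond-ii  : 2 * pmax p ≤ length (after j* (properSchedule a i))
    cond-iii : P p (upTo j* (properSchedule a i)) + 4 * (pmax p * pmax p)
                 ≤ P p (upTo j* (properSchedule a h))

JI : ∀ {n m} → (Fin n → ℕ) → (Fin n → Fin m) → Fin n → Fin m → List (Fin n)
JI p a j* i = take (2 * pmax p) (after j* (properSchedule a i))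

JH : ∀ {n m} → (Fin n → ℕ) → (Fin n → Fin m) → Fin n → Fin m → List (Fin n)
JH p a j* h = let L = upTo j* (properSchedule a h)
              in drop (length L ∸ 2 * pmax p) L

beforeJH : ∀ {n m} → (Fin n → ℕ) → (Fin n → Fin m) → Fin n → Fin m → List (Fin n)
beforeJH p a j* h = let L = upTo j* (properSchedule a h)
                    in take (length L ∸ 2 * pmax p) L

-- The choice of J_{H'} ⊆ J_H and J_{I'} ⊆ J_I is encoded by membership masks
-- bH, bI : J_{H'} = filterᵇ bH J_H, J_{H''} = J_H \ J_{H'} = filterᵇ (not ∘ bH) J_H, etc.
record ValidChoice {n m} (p : Fin n → ℕ) (a : Fin n → Fin m)
                   (j* : Fin n) (h i : Fin m) (bH bI : Fin n → Bool) : Set where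
  field
    H'-nonempty : ¬ (filterᵇ bH (JH p a j* h) ≡ [])
    I'-nonempty : ¬ (filterᵇ bI (JI p a j* i) ≡ [])
    equal-P     : P p (filterᵇ bH (JH p a j* h)) ≡ P p (filterᵇ bI (JI p a j* i))

intermediate : ∀ {n m} → (Fin n → ℕ) → (Fin n → Fin m) → Fin n → Fin m → Fin m
             → (bH bI : Fin n → Bool) → Schedule n m
intermediate p a j* h i bH bI k with does (k ≟ᶠ h)
... | true  = beforeJH p a j* h
              ++ filterᵇ (λ j → not (bH j)) (JH p a j* h)
              ++ filterᵇ bI (JI p a j* i)
              ++ after j* (properSchedule a h)
... | false with does (k ≟ᶠ i)
... | true  = upTo j* (properSchedule a i)
              ++ filterᵇ bH (JH p a j* h)
              ++ filterᵇ (λ j → not (bI j)) (JI p a j* i)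
              ++ drop (2 * pmax p) (after j* (properSchedule a i))
... | false = properSchedule a k

{-# OPTIONS --safe #-}
-- Scaling by p_{j*}, every weight splits as p_{j*} w_j = w_{j*} p_j + e_j − e′_j with
-- e, e′ ≥ 0; by the ordering of the ratios, e vanishes on the jobs after j* (those of J_I)
-- and e′ on the jobs up to j* (those of J_H). The swap changes only the blocks J_H (from
-- time B on M_h) and J_I (from time A on M_i); since P(J_{H'}) = P(J_{I'}) everything
-- behind them keeps its completion time.
--  * With weights p_j a block started at t costs ((t + P)² − t² + Σ p_j²) / 2, so the
--    p-part of the cost does not change.
--  * Every job of J_H completes no later than before, so the e-part does not increase.
--  * Every job of J_I completes no earlier: on M_h the jobs of J_{I'} start after
--    B ≥ A + P(J_I), which is condition (iii) since each block has load at most 2 p_max².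
--    So the e′-part does not decrease.
module Submission where

open import Defs
open import Data.Nat using (ℕ; zero; suc; _+_; _*_; _∸_; _≤_; _⊔_; s≤s; z≤n; NonZero; >-nonZero)
open import Data.Nat.Properties
open import Data.Nat.ListAction using (sum)
open import Data.Nat.ListAction.Properties using (sum-++)
open import Data.Nat.Tactic.RingSolver using (solve-∀)
open import Data.Bool using (Bool; true; false; not)
open import Data.Fin using (Fin; _<_; punchIn; punchOut)
import Data.Fin as Fin
import Data.Fin.Properties as Fin
open import Data.List using (List; []; _∷_; _++_; map; filterᵇ; length; take; drop; foldr; allFin; tabulate)
open import Data.List.Properties using (map-++; map-cong; map-tabulate; take++drop≡id; length-take; length-drop; ++-assoc; filter-all; filter-none; filter-accept; filter-reject)
open import Data.List.Relation.Unary.All as All using (All; []; _∷_)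
open import Data.List.Relation.Unary.All.Properties using (all-filter; filter⁺; take⁺; drop⁺)
open import Data.List.Relation.Unary.AllPairs using (AllPairs; []; _∷_)
import Data.List.Relation.Unary.AllPairs.Properties as AllPairs
open import Data.List.Relation.Unary.Any using (here; there)
open import Data.List.Membership.Propositional using (_∈_)
open import Data.List.Membership.Propositional.Properties using (∈-map⁺; ∈-allFin)
open import Data.Product using (proj₁; proj₂)
open import Data.Sum using ([_,_]′)
open import Data.Vec.Functional using (Vector)
open import Algebra.Properties.CommutativeMonoid.Sum +-0-commutativeMonoid
  using (sum-remove; sum-cong-≗) renaming (sum to ∑)
open import Algebra.Properties.CommutativeSemigroup +-commutativeSemigroup using (x∙yz≈y∙xz)
open import Function using (_∘_; id)
open import Relation.Nullary using (yes; no; contradiction)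
open import Relation.Nullary.Decidable using (T?; dec-true; dec-false)
open import Relation.Binary.PropositionalEquality

m+[n∸m]≡n+[m∸n] : ∀ m n → m + (n ∸ m) ≡ n + (m ∸ n)
m+[n∸m]≡n+[m∸n] m n = [ ordered , sym ∘ ordered ]′ (≤-total m n)
  where
  ordered : ∀ {m n} → m ≤ n → m + (n ∸ m) ≡ n + (m ∸ n)
  ordered {m} {n} m≤n = begin
    m + (n ∸ m) ≡⟨ m+[n∸m]≡n m≤n ⟩
    n           ≡⟨ +-identityʳ n ⟨
    n + 0       ≡⟨ cong (n +_) (m≤n⇒m∸n≡0 m≤n) ⟨
    n + (m ∸ n) ∎
    where open ≡-Reasoning

+-mono-middles : ∀ a₁ a₂ b₁ b₂ {m₁ m₂ n₁ n₂} → n₁ + n₂ ≤ m₁ + m₂ →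
                 (a₁ + n₁ + b₁) + (a₂ + n₂ + b₂) ≤ (a₁ + m₁ + b₁) + (a₂ + m₂ + b₂)
+-mono-middles a₁ a₂ b₁ b₂ {m₁} {m₂} {n₁} {n₂} le =
  subst₂ _≤_ (regroup a₁ a₂ b₁ b₂ n₁ n₂) (regroup a₁ a₂ b₁ b₂ m₁ m₂) (+-monoˡ-≤ (a₁ + a₂ + b₁ + b₂) le)
  where
  regroup : ∀ a₁ a₂ b₁ b₂ u₁ u₂ → (u₁ + u₂) + (a₁ + a₂ + b₁ + b₂) ≡ (a₁ + u₁ + b₁) + (a₂ + u₂ + b₂)
  regroup = solve-∀

P-++ : ∀ {n} (g : Fin n → ℕ) xs ys → P g (xs ++ ys) ≡ P g xs + P g ys
P-++ g xs ys = trans (cong sum (map-++ g xs ys)) (sum-++ (map g xs) (map g ys))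

P-filterᵇ : ∀ {n} (g : Fin n → ℕ) (b : Fin n → Bool) L →
            P g (filterᵇ b L) + P g (filterᵇ (not ∘ b) L) ≡ P g L
P-filterᵇ g b [] = refl
P-filterᵇ g b (x ∷ L) with b x
... | true  = trans (+-assoc (g x) _ _) (cong (g x +_) (P-filterᵇ g b L))
... | false = trans (x∙yz≈y∙xz (P g (filterᵇ b L)) (g x) _) (cong (g x +_) (P-filterᵇ g b L))

Linear : ∀ {n} → ((Fin n → ℕ) → ℕ) → Set
Linear Φ = ∀ c d f g f′ g′ → (∀ j → c * f j + g j ≡ d * f′ j + g′ j) → c * Φ f + Φ g ≡ d * Φ f′ + Φ g′

Linear-+ : ∀ {n} {Φ Ψ : (Fin n → ℕ) → ℕ} → Linear Φ → Linear Ψ → Linear (λ f → Φ f + Ψ f)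
Linear-+ {Φ = Φ} {Ψ} linΦ linΨ c d f g f′ g′ eq = begin
    c * (Φ f + Ψ f) + (Φ g + Ψ g)          ≡⟨ regroup c (Φ f) (Φ g) (Ψ f) (Ψ g) ⟩
    (c * Φ f + Φ g) + (c * Ψ f + Ψ g)      ≡⟨ cong₂ _+_ (linΦ c d f g f′ g′ eq) (linΨ c d f g f′ g′ eq) ⟩
    (d * Φ f′ + Φ g′) + (d * Ψ f′ + Ψ g′)  ≡⟨ regroup d (Φ f′) (Φ g′) (Ψ f′) (Ψ g′) ⟨
    d * (Φ f′ + Ψ f′) + (Φ g′ + Ψ g′)      ∎
  where
  open ≡-Reasoning
  regroup : ∀ c x y u v → c * (x + u) + (y + v) ≡ (c * x + y) + (c * u + v)
  regroup = solve-∀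

module _ {n : ℕ} (p : Fin n → ℕ) where

  cost : (Fin n → ℕ) → ℕ → List (Fin n) → ℕ
  cost f t []      = 0
  cost f t (j ∷ L) = f j * (t + p j) + cost f (t + p j) L

  sum-completions : ∀ f t L → sum (map (λ x → f (proj₁ x) * proj₂ x) (completions p t L)) ≡ cost f t L
  sum-completions f t []      = refl
  sum-completions f t (j ∷ L) = cong (f j * (t + p j) +_) (sum-completions f (t + p j) L)

  cost-++ : ∀ f t xs ys → cost f t (xs ++ ys) ≡ cost f t xs + cost f (t + P p xs) ys
  cost-++ f t []       ys = cong (λ s → cost f s ys) (sym (+-identityʳ t))
  cost-++ f t (x ∷ xs) ys rewrite cost-++ f (t + p x) xs ys | +-assoc t (p x) (P p xs) =
    sym (+-assoc (f x * (t + p x)) (cost f (t + p x) xs) (cost f (t + (p x + P p xs)) ys))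

  cost-++-++ : ∀ f t xs ys zs →
               cost f t (xs ++ ys ++ zs) ≡ cost f t xs + cost f (t + P p xs) ys + cost f (t + P p (xs ++ ys)) zs
  cost-++-++ f t xs ys zs = begin
    cost f t (xs ++ ys ++ zs)       ≡⟨ cong (cost f t) (++-assoc xs ys zs) ⟨
    cost f t ((xs ++ ys) ++ zs)     ≡⟨ cost-++ f t (xs ++ ys) zs ⟩
    cost f t (xs ++ ys) + cost f (t + P p (xs ++ ys)) zs
      ≡⟨ cong (_+ cost f (t + P p (xs ++ ys)) zs) (cost-++ f t xs ys) ⟩
    cost f t xs + cost f (t + P p xs) ys + cost f (t + P p (xs ++ ys)) zs ∎
    where open ≡-Reasoning

  cost-linear : ∀ t L → Linear (λ f → cost f t L)
  cost-linear t []      c d _ _ _ _ _ = cong (_+ 0) (trans (*-zeroʳ c) (sym (*-zeroʳ d)))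
  cost-linear t (j ∷ L) c d f g f′ g′ eq = begin
      c * (f j * T + cost f T L) + (g j * T + cost g T L)
    ≡⟨ regroup c (f j) (g j) T (cost f T L) (cost g T L) ⟩
      (c * f j + g j) * T + (c * cost f T L + cost g T L)
    ≡⟨ cong₂ (λ x y → x * T + y) (eq j) (cost-linear T L c d f g f′ g′ eq) ⟩
      (d * f′ j + g′ j) * T + (d * cost f′ T L + cost g′ T L)
    ≡⟨ regroup d (f′ j) (g′ j) T (cost f′ T L) (cost g′ T L) ⟨
      d * (f′ j * T + cost f′ T L) + (g′ j * T + cost g′ T L)
    ∎
    where
    open ≡-Reasoning
    T : ℕ
    T = t + p j
    regroup : ∀ c x y T r s → c * (x * T + r) + (y * T + s) ≡ (c * x + y) * T + (c * r + s)
    regroup = solve-∀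

  cost-mono-≤ : ∀ f {t t′} → t ≤ t′ → ∀ L → cost f t L ≤ cost f t′ L
  cost-mono-≤ f t≤t′ []      = ≤-refl
  cost-mono-≤ f t≤t′ (j ∷ L) =
    +-mono-≤ (*-monoʳ-≤ (f j) (+-monoˡ-≤ (p j) t≤t′)) (cost-mono-≤ f (+-monoˡ-≤ (p j) t≤t′) L)

  cost-zero : ∀ {f} t {L} → All (λ j → f j ≡ 0) L → cost f t L ≡ 0
  cost-zero t []                = refl
  cost-zero t {j ∷ _} (fj≡0 ∷ zs) rewrite fj≡0 = cost-zero (t + p j) zs

  cost-filterᵇ-earlier : ∀ f b {t t′} → t′ ≤ t → ∀ L →
                         cost f t (filterᵇ (not ∘ b) L) + cost f t′ (filterᵇ b L) ≤ cost f t L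
  cost-filterᵇ-earlier f b t′≤t [] = ≤-refl
  cost-filterᵇ-earlier f b {t} {t′} t′≤t (x ∷ L) with b x
  ... | true = begin
      cost f t R + (f x * (t′ + p x) + cost f (t′ + p x) K)
    ≡⟨ x∙yz≈y∙xz (cost f t R) (f x * (t′ + p x)) (cost f (t′ + p x) K) ⟩
      f x * (t′ + p x) + (cost f t R + cost f (t′ + p x) K)
    ≤⟨ +-mono-≤ (*-monoʳ-≤ (f x) (+-monoˡ-≤ (p x) t′≤t))
                (+-monoˡ-≤ _ (cost-mono-≤ f (m≤m+n t (p x)) R)) ⟩
      f x * (t + p x) + (cost f (t + p x) R + cost f (t′ + p x) K)
    ≤⟨ +-monoʳ-≤ _ (cost-filterᵇ-earlier f b (+-monoˡ-≤ (p x) t′≤t) L) ⟩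
      f x * (t + p x) + cost f (t + p x) L
    ∎
    where
    open ≤-Reasoning
    R K : List (Fin n)
    R = filterᵇ (not ∘ b) L
    K = filterᵇ b L
  ... | false = begin
      f x * (t + p x) + cost f (t + p x) R + cost f t′ K
    ≡⟨ +-assoc (f x * (t + p x)) _ _ ⟩
      f x * (t + p x) + (cost f (t + p x) R + cost f t′ K)
    ≤⟨ +-monoʳ-≤ _ (cost-filterᵇ-earlier f b (≤-trans t′≤t (m≤m+n t (p x))) L) ⟩
      f x * (t + p x) + cost f (t + p x) L
    ∎
    where
    open ≤-Reasoning
    R K : List (Fin n)
    R = filterᵇ (not ∘ b) L
    K = filterᵇ b L

  cost-filterᵇ-later : ∀ f b {t t′} L → t + P p L ≤ t′ →
                       cost f t L ≤ cost f (t + P p (filterᵇ b L)) (filterᵇ (not ∘ b) L) + cost f t′ (filterᵇ b L)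
  cost-filterᵇ-later f b [] _ = ≤-refl
  cost-filterᵇ-later f b {t} {t′} (x ∷ L) t+PL≤t′ with b x
  ... | true = begin
      f x * (t + p x) + cost f (t + p x) L
    ≤⟨ +-mono-≤ (*-monoʳ-≤ (f x) (+-monoˡ-≤ (p x) (m+n≤o⇒m≤o t t+PL≤t′)))
                (cost-filterᵇ-later f b L (≤-trans (≤-reflexive (+-assoc t (p x) (P p L)))
                                                     (≤-trans t+PL≤t′ (m≤m+n t′ (p x))))) ⟩
      f x * (t′ + p x) + (cost f (t + p x + P p K) R + cost f (t′ + p x) K)
    ≡⟨ x∙yz≈y∙xz (f x * (t′ + p x)) (cost f (t + p x + P p K) R) (cost f (t′ + p x) K) ⟩
      cost f (t + p x + P p K) R + (f x * (t′ + p x) + cost f (t′ + p x) K)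
    ≡⟨ cong (λ s → cost f s R + (f x * (t′ + p x) + cost f (t′ + p x) K)) (+-assoc t (p x) (P p K)) ⟩
      cost f (t + (p x + P p K)) R + (f x * (t′ + p x) + cost f (t′ + p x) K)
    ∎
    where
    open ≤-Reasoning
    R K : List (Fin n)
    R = filterᵇ (not ∘ b) L
    K = filterᵇ b L
  ... | false = begin
      f x * (t + p x) + cost f (t + p x) L
    ≤⟨ +-mono-≤ (*-monoʳ-≤ (f x) (+-monoˡ-≤ (p x) (m≤m+n t (P p K))))
                (cost-filterᵇ-later f b L (≤-trans (≤-reflexive (+-assoc t (p x) (P p L))) t+PL≤t′)) ⟩
      f x * (t + P p K + p x) + (cost f (t + p x + P p K) R + cost f t′ K)
    ≡⟨ cong (λ s → f x * (t + P p K + p x) + (cost f s R + cost f t′ K)) (+-comm-middle t (p x) (P p K)) ⟩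
      f x * (t + P p K + p x) + (cost f (t + P p K + p x) R + cost f t′ K)
    ≡⟨ +-assoc (f x * (t + P p K + p x)) _ _ ⟨
      f x * (t + P p K + p x) + cost f (t + P p K + p x) R + cost f t′ K
    ∎
    where
    open ≤-Reasoning
    R K : List (Fin n)
    R = filterᵇ (not ∘ b) L
    K = filterᵇ b L
    +-comm-middle : ∀ a b c → a + b + c ≡ a + c + b
    +-comm-middle = solve-∀

  sumSq : List (Fin n) → ℕ
  sumSq = P (λ j → p j * p j)

  cost-self : ∀ t L → 2 * cost p t L ≡ (2 * t + P p L) * P p L + sumSq L
  cost-self t []      = sym (trans (+-identityʳ _) (*-zeroʳ (2 * t + 0)))
  cost-self t (j ∷ L) = begin
      2 * (p j * (t + p j) + cost p (t + p j) L)
    ≡⟨ *-distribˡ-+ 2 (p j * (t + p j)) _ ⟩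
      2 * (p j * (t + p j)) + 2 * cost p (t + p j) L
    ≡⟨ cong (2 * (p j * (t + p j)) +_) (cost-self (t + p j) L) ⟩
      2 * (p j * (t + p j)) + ((2 * (t + p j) + P p L) * P p L + sumSq L)
    ≡⟨ expand (p j) t (P p L) (sumSq L) ⟩
      (2 * t + (p j + P p L)) * (p j + P p L) + (p j * p j + sumSq L)
    ∎
    where
    open ≡-Reasoning
    expand : ∀ x t Y Q → 2 * (x * (t + x)) + ((2 * (t + x) + Y) * Y + Q) ≡ (2 * t + (x + Y)) * (x + Y) + (x * x + Q)
    expand = solve-∀

  cost-swap-middle : ∀ f t X₁ X₂ {M₁ N₁ M₂ N₂} Y₁ Y₂ → P p N₁ ≡ P p M₁ → P p N₂ ≡ P p M₂ →
    cost f (t + P p X₁) N₁ + cost f (t + P p X₂) N₂ ≤ cost f (t + P p X₁) M₁ + cost f (t + P p X₂) M₂ →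
    cost f t (X₁ ++ N₁ ++ Y₁) + cost f t (X₂ ++ N₂ ++ Y₂) ≤ cost f t (X₁ ++ M₁ ++ Y₁) + cost f t (X₂ ++ M₂ ++ Y₂)
  cost-swap-middle f t X₁ X₂ {M₁} {N₁} {M₂} {N₂} Y₁ Y₂ loads₁ loads₂ middle = begin
      cost f t (X₁ ++ N₁ ++ Y₁) + cost f t (X₂ ++ N₂ ++ Y₂)
    ≡⟨ cong₂ _+_ (cost-++-++ f t X₁ N₁ Y₁) (cost-++-++ f t X₂ N₂ Y₂) ⟩
      (x₁ + cost f s₁ N₁ + cost f (t + P p (X₁ ++ N₁)) Y₁) + (x₂ + cost f s₂ N₂ + cost f (t + P p (X₂ ++ N₂)) Y₂)
    ≡⟨ cong₂ (λ u v → (x₁ + cost f s₁ N₁ + cost f (t + u) Y₁) + (x₂ + cost f s₂ N₂ + cost f (t + v) Y₂))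
             (same-load X₁ loads₁) (same-load X₂ loads₂) ⟩
      (x₁ + cost f s₁ N₁ + y₁) + (x₂ + cost f s₂ N₂ + y₂)
    ≤⟨ +-mono-middles x₁ x₂ y₁ y₂ middle ⟩
      (x₁ + cost f s₁ M₁ + y₁) + (x₂ + cost f s₂ M₂ + y₂)
    ≡⟨ cong₂ _+_ (cost-++-++ f t X₁ M₁ Y₁) (cost-++-++ f t X₂ M₂ Y₂) ⟨
      cost f t (X₁ ++ M₁ ++ Y₁) + cost f t (X₂ ++ M₂ ++ Y₂)
    ∎
    where
    open ≤-Reasoning
    s₁ s₂ x₁ x₂ y₁ y₂ : ℕ
    s₁ = t + P p X₁
    s₂ = t + P p X₂
    x₁ = cost f t X₁
    x₂ = cost f t X₂
    y₁ = cost f (t + P p (X₁ ++ M₁)) Y₁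
    y₂ = cost f (t + P p (X₂ ++ M₂)) Y₂
    same-load : ∀ X {N M} → P p N ≡ P p M → P p (X ++ N) ≡ P p (X ++ M)
    same-load X {N} {M} eq = trans (P-++ p X N) (trans (cong (P p X +_) eq) (sym (P-++ p X M)))

-- B and A are the start times of J_H on M_h and of J_I on M_i; old f and new f are the
-- f-weighted completion times of the jobs of J_H ∪ J_I before and after the swap.
module BlockExchange {n : ℕ} (p : Fin n → ℕ) (bH bI : Fin n → Bool) (JH JI : List (Fin n)) (B A : ℕ)
                     (balanced : P p (filterᵇ bH JH) ≡ P p (filterᵇ bI JI))
                     (gap : A + P p JI ≤ B) where

  H′ H″ I′ I″ : List (Fin n)
  H′ = filterᵇ bH JH
  H″ = filterᵇ (not ∘ bH) JH
  I′ = filterᵇ bI JI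
  I″ = filterᵇ (not ∘ bI) JI

  old new : (Fin n → ℕ) → ℕ
  old f = cost p f B JH + cost p f A JI
  new f = cost p f B (H″ ++ I′) + cost p f A (H′ ++ I″)

  new-load-H : P p (H″ ++ I′) ≡ P p JH
  new-load-H = begin
    P p (H″ ++ I′)    ≡⟨ P-++ p H″ I′ ⟩
    P p H″ + P p I′   ≡⟨ cong (P p H″ +_) balanced ⟨
    P p H″ + P p H′   ≡⟨ +-comm (P p H″) (P p H′) ⟩
    P p H′ + P p H″   ≡⟨ P-filterᵇ p bH JH ⟩
    P p JH            ∎
    where open ≡-Reasoning

  new-load-I : P p (H′ ++ I″) ≡ P p JI
  new-load-I = begin
    P p (H′ ++ I″)    ≡⟨ P-++ p H′ I″ ⟩
    P p H′ + P p I″   ≡⟨ cong (_+ P p I″) balanced ⟩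
    P p I′ + P p I″   ≡⟨ P-filterᵇ p bI JI ⟩
    P p JI            ∎
    where open ≡-Reasoning

  P-exchange : ∀ g → P g (H″ ++ I′) + P g (H′ ++ I″) ≡ P g JH + P g JI
  P-exchange g = begin
    P g (H″ ++ I′) + P g (H′ ++ I″)          ≡⟨ cong₂ _+_ (P-++ g H″ I′) (P-++ g H′ I″) ⟩
    (P g H″ + P g I′) + (P g H′ + P g I″)    ≡⟨ regroup (P g H″) (P g I′) (P g H′) (P g I″) ⟩
    (P g H′ + P g H″) + (P g I′ + P g I″)    ≡⟨ cong₂ _+_ (P-filterᵇ g bH JH) (P-filterᵇ g bI JI) ⟩
    P g JH + P g JI                          ∎
    where
    open ≡-Reasoning
    regroup : ∀ a b c d → (a + b) + (c + d) ≡ (c + a) + (b + d)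
    regroup = solve-∀

  old-linear : Linear old
  old-linear = Linear-+ (cost-linear p B JH) (cost-linear p A JI)

  new-linear : Linear new
  new-linear = Linear-+ (cost-linear p B (H″ ++ I′)) (cost-linear p A (H′ ++ I″))

  new-self : new p ≡ old p
  new-self = *-cancelˡ-≡ (new p) (old p) 2 (begin
      2 * new p
    ≡⟨ *-distribˡ-+ 2 (cost p p B (H″ ++ I′)) _ ⟩
      2 * cost p p B (H″ ++ I′) + 2 * cost p p A (H′ ++ I″)
    ≡⟨ cong₂ _+_ (cost-self p B (H″ ++ I′)) (cost-self p A (H′ ++ I″)) ⟩
      (2 * B + P p (H″ ++ I′)) * P p (H″ ++ I′) + sumSq p (H″ ++ I′)
        + ((2 * A + P p (H′ ++ I″)) * P p (H′ ++ I″) + sumSq p (H′ ++ I″))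
    ≡⟨ cong₂ (λ x y → (2 * B + x) * x + sumSq p (H″ ++ I′) + ((2 * A + y) * y + sumSq p (H′ ++ I″)))
             new-load-H new-load-I ⟩
      (2 * B + P p JH) * P p JH + sumSq p (H″ ++ I′) + ((2 * A + P p JI) * P p JI + sumSq p (H′ ++ I″))
    ≡⟨ regroup sqH sqI (sumSq p (H″ ++ I′)) (sumSq p (H′ ++ I″)) ⟩
      (2 * B + P p JH) * P p JH + (2 * A + P p JI) * P p JI + (sumSq p (H″ ++ I′) + sumSq p (H′ ++ I″))
    ≡⟨ cong ((2 * B + P p JH) * P p JH + (2 * A + P p JI) * P p JI +_) (P-exchange (λ j → p j * p j)) ⟩
      (2 * B + P p JH) * P p JH + (2 * A + P p JI) * P p JI + (sumSq p JH + sumSq p JI)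
    ≡⟨ regroup sqH sqI (sumSq p JH) (sumSq p JI) ⟨
      (2 * B + P p JH) * P p JH + sumSq p JH + ((2 * A + P p JI) * P p JI + sumSq p JI)
    ≡⟨ cong₂ _+_ (cost-self p B JH) (cost-self p A JI) ⟨
      2 * cost p p B JH + 2 * cost p p A JI
    ≡⟨ *-distribˡ-+ 2 (cost p p B JH) _ ⟨
      2 * old p
    ∎)
    where
    open ≡-Reasoning
    sqH sqI : ℕ
    sqH = (2 * B + P p JH) * P p JH
    sqI = (2 * A + P p JI) * P p JI
    regroup : ∀ a b x y → a + x + (b + y) ≡ a + b + (x + y)
    regroup = solve-∀

  new-earlier : ∀ {f} → All (λ j → f j ≡ 0) JI → new f ≤ old f
  new-earlier {f} f≡0-on-JI = begin
      cost p f B (H″ ++ I′) + cost p f A (H′ ++ I″)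
    ≡⟨ cong₂ _+_ (cost-++ p f B H″ I′) (cost-++ p f A H′ I″) ⟩
      (cost p f B H″ + cost p f (B + P p H″) I′) + (cost p f A H′ + cost p f (A + P p H′) I″)
    ≡⟨ cong₂ (λ x y → (cost p f B H″ + x) + (cost p f A H′ + y))
             (cost-zero p _ (filter⁺ (T? ∘ bI) f≡0-on-JI)) (cost-zero p _ (filter⁺ (T? ∘ not ∘ bI) f≡0-on-JI)) ⟩
      (cost p f B H″ + 0) + (cost p f A H′ + 0)
    ≡⟨ cong₂ _+_ (+-identityʳ (cost p f B H″)) (+-identityʳ (cost p f A H′)) ⟩
      cost p f B H″ + cost p f A H′
    ≤⟨ cost-filterᵇ-earlier p f bH (m+n≤o⇒m≤o A gap) JH ⟩
      cost p f B JH
    ≤⟨ m≤m+n _ _ ⟩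
      old f
    ∎
    where open ≤-Reasoning

  new-later : ∀ {f} → All (λ j → f j ≡ 0) JH → old f ≤ new f
  new-later {f} f≡0-on-JH = begin
      cost p f B JH + cost p f A JI
    ≡⟨ cong (_+ cost p f A JI) (cost-zero p B f≡0-on-JH) ⟩
      cost p f A JI
    ≤⟨ cost-filterᵇ-later p f bI JI (≤-trans gap (m≤m+n B (P p H″))) ⟩
      cost p f (A + P p I′) I″ + cost p f (B + P p H″) I′
    ≡⟨ +-comm (cost p f (A + P p I′) I″) _ ⟩
      cost p f (B + P p H″) I′ + cost p f (A + P p I′) I″
    ≡⟨ cong (λ x → cost p f (B + P p H″) I′ + cost p f (A + x) I″) balanced ⟨
      cost p f (B + P p H″) I′ + cost p f (A + P p H′) I″
    ≡⟨ cong₂ (λ x y → (x + cost p f (B + P p H″) I′) + (y + cost p f (A + P p H′) I″))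
             (cost-zero p B (filter⁺ (T? ∘ not ∘ bH) f≡0-on-JH)) (cost-zero p A (filter⁺ (T? ∘ bH) f≡0-on-JH)) ⟨
      (cost p f B H″ + cost p f (B + P p H″) I′) + (cost p f A H′ + cost p f (A + P p H′) I″)
    ≡⟨ cong₂ _+_ (cost-++ p f B H″ I′) (cost-++ p f A H′ I″) ⟨
      new f
    ∎
    where open ≤-Reasoning

  new≤old : ∀ {w e e′ : Fin n → ℕ} c d .{{_ : NonZero c}} → (∀ j → c * w j + e′ j ≡ d * p j + e j) →
            All (λ j → e j ≡ 0) JI → All (λ j → e′ j ≡ 0) JH → new w ≤ old w
  new≤old {w} {e} {e′} c d split e≡0-on-JI e′≡0-on-JH =
    *-cancelˡ-≤ c (+-cancelʳ-≤ (new e′) (c * new w) (c * old w) (begin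
      c * new w + new e′  ≡⟨ new-linear c d w e′ p e split ⟩
      d * new p + new e   ≤⟨ +-mono-≤ (≤-reflexive (cong (d *_) new-self)) (new-earlier e≡0-on-JI) ⟩
      d * old p + old e   ≡⟨ old-linear c d w e′ p e split ⟨
      c * old w + old e′  ≤⟨ +-monoʳ-≤ (c * old w) (new-later e′≡0-on-JH) ⟩
      c * old w + new e′  ∎))
    where open ≤-Reasoning

∈⇒≤foldr-⊔ : ∀ {x} {xs : List ℕ} → x ∈ xs → x ≤ foldr _⊔_ 0 xs
∈⇒≤foldr-⊔ {xs = y ∷ _} (here refl)  = m≤m⊔n y _
∈⇒≤foldr-⊔ {xs = y ∷ _} (there x∈xs) = ≤-trans (∈⇒≤foldr-⊔ x∈xs) (m≤n⊔m y _)

p≤pmax : ∀ {n} (p : Fin n → ℕ) j → p j ≤ pmax p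
p≤pmax p j = ∈⇒≤foldr-⊔ (∈-map⁺ p (∈-allFin j))

P≤length*pmax : ∀ {n} (p : Fin n → ℕ) L → P p L ≤ length L * pmax p
P≤length*pmax p []      = z≤n
P≤length*pmax p (j ∷ L) = +-mono-≤ (p≤pmax p j) (P≤length*pmax p L)

length-take-≤ : ∀ {A : Set} k (xs : List A) → length (take k xs) ≤ k
length-take-≤ k xs = ≤-trans (≤-reflexive (length-take k xs)) (m⊓n≤m k (length xs))

length-drop-length∸-≤ : ∀ {A : Set} k (xs : List A) → length (drop (length xs ∸ k) xs) ≤ k
length-drop-length∸-≤ k xs = begin
  length (drop (length xs ∸ k) xs) ≡⟨ length-drop (length xs ∸ k) xs ⟩
  length xs ∸ (length xs ∸ k)      ≤⟨ m≤n+o⇒m∸n≤o (length xs) (length xs ∸ k) len≤ ⟩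
  k                                ∎
  where
  open ≤-Reasoning
  len≤ : length xs ≤ (length xs ∸ k) + k
  len≤ = ≤-trans (m≤n+m∸n (length xs) k) (≤-reflexive (+-comm k _))

upTo++after : ∀ {n} (j* : Fin n) {L} → AllPairs _<_ L → upTo j* L ++ after j* L ≡ L
upTo++after j* {[]}    []             = refl
upTo++after j* {x ∷ L} (x<L ∷ sorted) with x Fin.≤? j*
... | yes x≤j* = begin
  upTo j* (x ∷ L) ++ after j* (x ∷ L) ≡⟨ cong₂ _++_ (filter-accept (Fin._≤? j*) x≤j*)
                                                   (filter-reject (j* Fin.<?_) (≤⇒≯ x≤j*)) ⟩
  x ∷ (upTo j* L ++ after j* L)       ≡⟨ cong (x ∷_) (upTo++after j* sorted) ⟩
  x ∷ L                               ∎
  where open ≡-Reasoning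
... | no x≰j* = cong₂ _++_ (filter-none (Fin._≤? j*) (All.map <⇒≱ j*<x∷L)) (filter-all (j* Fin.<?_) j*<x∷L)
  where
  j*<x : j* < x
  j*<x = ≰⇒> x≰j*
  j*<x∷L : All (j* <_) (x ∷ L)
  j*<x∷L = j*<x ∷ All.map (<-trans j*<x) x<L

properSchedule-sorted : ∀ {n m} (a : Fin n → Fin m) k → AllPairs _<_ (properSchedule a k)
properSchedule-sorted a k = AllPairs.filter⁺ (λ j → a j Fin.≟ k) (AllPairs.tabulate⁺-< id)

sum-tabulate : ∀ {m} (F : Fin m → ℕ) → sum (tabulate F) ≡ ∑ F
sum-tabulate {zero}  F = refl
sum-tabulate {suc m} F = cong (F Fin.zero +_) (sum-tabulate (F ∘ Fin.suc))

weightedCompletion≡∑cost : ∀ {n m} (p w : Fin n → ℕ) (S : Schedule n m) →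
                           weightedCompletion p w S ≡ ∑ (λ k → cost p w 0 (S k))
weightedCompletion≡∑cost {m = m} p w S = begin
  weightedCompletion p w S                       ≡⟨ cong sum (map-cong (λ k → sum-completions p w 0 (S k)) (allFin m)) ⟩
  sum (map (λ k → cost p w 0 (S k)) (allFin m))  ≡⟨ cong sum (map-tabulate id (λ k → cost p w 0 (S k))) ⟩
  sum (tabulate (λ k → cost p w 0 (S k)))        ≡⟨ sum-tabulate (λ k → cost p w 0 (S k)) ⟩
  ∑ (λ k → cost p w 0 (S k))                     ∎
  where open ≡-Reasoning

∑-pick-two : ∀ {m} {h i : Fin (suc (suc m))} (h≢i : h ≢ i) (F : Vector ℕ (suc (suc m))) →
             ∑ F ≡ F h + F i + ∑ (F ∘ punchIn h ∘ punchIn (punchOut h≢i))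
∑-pick-two {h = h} {i} h≢i F = begin
  ∑ F                                             ≡⟨ sum-remove {i = h} F ⟩
  F h + ∑ (F ∘ punchIn h)                         ≡⟨ cong (F h +_) (sum-remove {i = punchOut h≢i} (F ∘ punchIn h)) ⟩
  F h + (F (punchIn h (punchOut h≢i)) + rest)     ≡⟨ cong (λ k → F h + (F k + rest)) (Fin.punchIn-punchOut h≢i) ⟩
  F h + (F i + rest)                              ≡⟨ +-assoc (F h) (F i) rest ⟨
  F h + F i + rest                                ∎
  where
  open ≡-Reasoning
  rest : ℕ
  rest = ∑ (F ∘ punchIn h ∘ punchIn (punchOut h≢i))

∑-mono-two : ∀ {m} {h i : Fin m} {F G : Vector ℕ m} → h ≢ i → (∀ k → k ≢ h → k ≢ i → F k ≡ G k) →
             F h + F i ≤ G h + G i → ∑ F ≤ ∑ G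
∑-mono-two {suc zero}    {Fin.zero} {Fin.zero} h≢i _ _ = contradiction refl h≢i
∑-mono-two {suc (suc m)} {h} {i} {F} {G} h≢i agree le = begin
  ∑ F                      ≡⟨ ∑-pick-two h≢i F ⟩
  F h + F i + ∑ (F ∘ π)    ≤⟨ +-mono-≤ le (≤-reflexive (sum-cong-≗ (λ k → agree (π k) (Fin.punchInᵢ≢i h _) (π≢i k)))) ⟩
  G h + G i + ∑ (G ∘ π)    ≡⟨ ∑-pick-two h≢i G ⟨
  ∑ G                      ∎
  where
  open ≤-Reasoning
  π : Fin m → Fin (suc (suc m))
  π = punchIn h ∘ punchIn (punchOut h≢i)
  π≢i : ∀ k → π k ≢ i
  π≢i k πk≡i = Fin.punchInᵢ≢i (punchOut h≢i) k
    (Fin.punchIn-injective h _ _ (trans πk≡i (sym (Fin.punchIn-punchOut h≢i))))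

SmithOrdered : ∀ {n} (p w : Fin n → ℕ) → Set
SmithOrdered p w = ∀ j k → j < k → w k * p j ≤ w j * p k

module SmithSplit {n : ℕ} (p w : Fin n → ℕ) (j* : Fin n) where

  excess deficit : Fin n → ℕ
  excess  j = w j * p j* ∸ w j* * p j
  deficit j = w j* * p j ∸ w j * p j*

  split : ∀ j → p j* * w j + deficit j ≡ w j* * p j + excess j
  split j rewrite *-comm (p j*) (w j) = m+[n∸m]≡n+[m∸n] (w j * p j*) (w j* * p j)

  excess-after : SmithOrdered p w → ∀ {j} → j* < j → excess j ≡ 0
  excess-after smith {j} j*<j = m≤n⇒m∸n≡0 (smith j* j j*<j)

  deficit-upTo : SmithOrdered p w → ∀ {j} → j Fin.≤ j* → deficit j ≡ 0
  deficit-upTo smith {j} j≤j* with j Fin.≟ j*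
  ... | yes refl = n∸n≡0 (w j* * p j*)
  ... | no j≢j*  = m≤n⇒m∸n≡0 (smith j j* (Fin.≤∧≢⇒< j≤j* j≢j*))

module Swap {n m : ℕ} (p : Fin n → ℕ) (a : Fin n → Fin m) (j* : Fin n) (h i : Fin m)
            (bH bI : Fin n → Bool) where

  σ σ′ : Schedule n m
  σ  = properSchedule a
  σ′ = intermediate p a j* h i bH bI

  pm : ℕ
  pm = pmax p

  B A : ℕ
  B = P p (beforeJH p a j* h)
  A = P p (upTo j* (σ i))

  JH-upTo : All (Fin._≤ j*) (JH p a j* h)
  JH-upTo = drop⁺ (length (upTo j* (σ h)) ∸ 2 * pm) (all-filter (Fin._≤? j*) (σ h))

  JI-after : All (j* <_) (JI p a j* i)
  JI-after = take⁺ (2 * pm) (all-filter (j* Fin.<?_) (σ i))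

  upTo-h : upTo j* (σ h) ≡ beforeJH p a j* h ++ JH p a j* h
  upTo-h = sym (take++drop≡id (length (upTo j* (σ h)) ∸ 2 * pm) (upTo j* (σ h)))

  machine-h : σ h ≡ beforeJH p a j* h ++ JH p a j* h ++ after j* (σ h)
  machine-h = begin
    σ h                                                            ≡⟨ upTo++after j* (properSchedule-sorted a h) ⟨
    upTo j* (σ h) ++ after j* (σ h)                                ≡⟨ cong (_++ after j* (σ h)) upTo-h ⟩
    (beforeJH p a j* h ++ JH p a j* h) ++ after j* (σ h)           ≡⟨ ++-assoc (beforeJH p a j* h) _ _ ⟩
    beforeJH p a j* h ++ JH p a j* h ++ after j* (σ h)             ∎
    where open ≡-Reasoning

  machine-i : σ i ≡ upTo j* (σ i) ++ JI p a j* i ++ drop (2 * pm) (after j* (σ i))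
  machine-i = begin
    σ i                                                            ≡⟨ upTo++after j* (properSchedule-sorted a i) ⟨
    upTo j* (σ i) ++ after j* (σ i)                                ≡⟨ cong (upTo j* (σ i) ++_) (take++drop≡id (2 * pm) (after j* (σ i))) ⟨
    upTo j* (σ i) ++ JI p a j* i ++ drop (2 * pm) (after j* (σ i)) ∎
    where open ≡-Reasoning

  intermediate-h : σ′ h ≡ beforeJH p a j* h ++ filterᵇ (not ∘ bH) (JH p a j* h)
                          ++ filterᵇ bI (JI p a j* i) ++ after j* (σ h)
  intermediate-h rewrite dec-true (h Fin.≟ h) refl = refl

  intermediate-i : h ≢ i → σ′ i ≡ upTo j* (σ i) ++ filterᵇ bH (JH p a j* h)
                                  ++ filterᵇ (not ∘ bI) (JI p a j* i) ++ drop (2 * pm) (after j* (σ i))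
  intermediate-i h≢i rewrite dec-false (i Fin.≟ h) (h≢i ∘ sym) | dec-true (i Fin.≟ i) refl = refl

  intermediate-other : ∀ {k} → k ≢ h → k ≢ i → σ′ k ≡ σ k
  intermediate-other {k} k≢h k≢i rewrite dec-false (k Fin.≟ h) k≢h | dec-false (k Fin.≟ i) k≢i = refl

  P-JH≤ : P p (JH p a j* h) ≤ 2 * pm * pm
  P-JH≤ = ≤-trans (P≤length*pmax p (JH p a j* h)) (*-monoˡ-≤ pm (length-drop-length∸-≤ (2 * pm) (upTo j* (σ h))))

  P-JI≤ : P p (JI p a j* i) ≤ 2 * pm * pm
  P-JI≤ = ≤-trans (P≤length*pmax p (JI p a j* i)) (*-monoˡ-≤ pm (length-take-≤ (2 * pm) (after j* (σ i))))

  gap : Admissible p a j* h i → A + P p (JI p a j* i) ≤ B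
  gap adm = +-cancelʳ-≤ (2 * pm * pm) (A + P p (JI p a j* i)) B (begin
    A + P p (JI p a j* i) + 2 * pm * pm ≤⟨ +-monoˡ-≤ (2 * pm * pm) (+-monoʳ-≤ A P-JI≤) ⟩
    A + 2 * pm * pm + 2 * pm * pm       ≡⟨ double-square A pm ⟩
    A + 4 * (pm * pm)                   ≤⟨ Admissible.cond-iii adm ⟩
    P p (upTo j* (σ h))                 ≡⟨ trans (cong (P p) upTo-h) (P-++ p (beforeJH p a j* h) _) ⟩
    B + P p (JH p a j* h)               ≤⟨ +-monoʳ-≤ B P-JH≤ ⟩
    B + 2 * pm * pm                     ∎)
    where
    open ≤-Reasoning
    double-square : ∀ x y → x + 2 * y * y + 2 * y * y ≡ x + 4 * (y * y)
    double-square = solve-∀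

  machines-distinct : 1 ≤ p j* → Admissible p a j* h i → h ≢ i
  machines-distinct p*≥1 adm refl = m+1+n≰m _ (≤-trans (+-monoʳ-≤ _ 1≤4pm²) (Admissible.cond-iii adm))
    where
    pm≥1 : 1 ≤ pm
    pm≥1 = ≤-trans p*≥1 (p≤pmax p j*)
    1≤4pm² : 1 ≤ 4 * (pm * pm)
    1≤4pm² = *-mono-≤ {1} {4} (s≤s z≤n) (*-mono-≤ pm≥1 pm≥1)

  swap-improves : (w : Fin n → ℕ) → 1 ≤ p j* → SmithOrdered p w → Admissible p a j* h i →
                  ValidChoice p a j* h i bH bI →
                  cost p w 0 (σ′ h) + cost p w 0 (σ′ i) ≤ cost p w 0 (σ h) + cost p w 0 (σ i)
  swap-improves w p*≥1 smith adm vc = begin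
      cost p w 0 (σ′ h) + cost p w 0 (σ′ i)
    ≡⟨ cong₂ (λ x y → cost p w 0 x + cost p w 0 y)
             (trans intermediate-h (cong (X₁ ++_) (sym (++-assoc H″ I′ Y₁))))
             (trans (intermediate-i (machines-distinct p*≥1 adm)) (cong (X₂ ++_) (sym (++-assoc H′ I″ Y₂)))) ⟩
      cost p w 0 (X₁ ++ (H″ ++ I′) ++ Y₁) + cost p w 0 (X₂ ++ (H′ ++ I″) ++ Y₂)
    ≤⟨ cost-swap-middle p w 0 X₁ X₂ Y₁ Y₂ new-load-H new-load-I
         (new≤old (p j*) (w j*) {{>-nonZero p*≥1}} split
                  (All.map (excess-after smith) JI-after) (All.map (deficit-upTo smith) JH-upTo)) ⟩
      cost p w 0 (X₁ ++ JH p a j* h ++ Y₁) + cost p w 0 (X₂ ++ JI p a j* i ++ Y₂)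
    ≡⟨ cong₂ (λ x y → cost p w 0 x + cost p w 0 y) machine-h machine-i ⟨
      cost p w 0 (σ h) + cost p w 0 (σ i)
    ∎
    where
    open ≤-Reasoning
    open SmithSplit p w j*
    open BlockExchange p bH bI (JH p a j* h) (JI p a j* i) B A (ValidChoice.equal-P vc) (gap adm)
    X₁ Y₁ X₂ Y₂ : List (Fin n)
    X₁ = beforeJH p a j* h
    Y₁ = after j* (σ h)
    X₂ = upTo j* (σ i)
    Y₂ = drop (2 * pm) (after j* (σ i))

lemma5 : ∀ {n m : ℕ} (p w : Fin n → ℕ)
         → (∀ j → 1 ≤ p j)
         → (∀ j k → j < k → w k * p j ≤ w j * p k)
         → (a : Fin n → Fin m) (j* : Fin n) (h i : Fin m)
         → Admissible p a j* h i
         → (bH bI : Fin n → Bool)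
         → ValidChoice p a j* h i bH bI
         → weightedCompletion p w (intermediate p a j* h i bH bI)
             ≤ weightedCompletion p w (properSchedule a)
lemma5 p w p≥1 smith a j* h i adm bH bI vc = begin
    weightedCompletion p w σ′      ≡⟨ weightedCompletion≡∑cost p w σ′ ⟩
    ∑ (λ k → cost p w 0 (σ′ k))   ≤⟨ ∑-mono-two (machines-distinct (p≥1 j*) adm)
                                                (λ k k≢h k≢i → cong (cost p w 0) (intermediate-other k≢h k≢i))
                                                (swap-improves w (p≥1 j*) smith adm vc) ⟩
    ∑ (λ k → cost p w 0 (σ k))    ≡⟨ weightedCompletion≡∑cost p w σ ⟨
    weightedCompletion p w σ       ∎
  where
  open Swap p a j* h i bH bI
  open ≤-Reasoning
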